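{- Let $A_1,\dots,A_{10}\in\mathbb{Q}$ with $A_1A_2A_3\neq0$ and $A_i \neq 0$ for at least one $i>3$, and suppose $F(x,y,z)=A_1x^3+A_2y^3+A_3z^3+A_4x^2y+A_5x^2z+A_6y^2x+A_7y^2z+A_8z^2x+A_9z^2y+A_{10}xyz=0$ has a nontrivial solution over every completion $\mathbb{Q}_p$ of $\mathbb{Q}$ ($p$ finite or infinite). Define the quadratic forms in variables $X,Y,Z,W,M,N$: $F_x = A_1X^2+A_2YW+A_3ZM+A_4XW+A_5XM+A_6XY+A_7YM+A_8XZ+A_9ZW+A_{10}XN$, $F_y = A_1XW+A_2Y^2+A_3ZN+A_4XY+A_5XN+A_6YW+A_7YN+A_8ZW+A_9YZ+A_{10}YM$, $F_z = A_1XM+A_2YN+A_3Z^2+A_4XN+A_5XZ+A_6YM+A_7YZ+A_8ZM+A_9ZN+A_{10}ZW$. Then the system $F_x=0,\ F_y=0,\ F_z=0,\ WM-XN=0,\ MN-ZW=0,\ WN-YM=0,\ W^2-XY=0,\ M^2-XZ=0,\ N^2-YZ=0$ has a common nontrivial rational solution if and only if $F(x,y,z)=0$ has a nontrivial rational solution.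
   Context: A solution is nontrivial if at least one of its components is nonzero. -}

module Defs where

open import Data.Nat as ℕ using (ℕ; suc)
open import Data.Nat.Primality using (Prime)
open import Data.Integer as ℤ using (ℤ; +_)
open import Data.Integer.Divisibility as ℤD using ()
open import Data.Rational as Q using (ℚ; ↥_; ↧_)
open import Data.Fin using (Fin; #_; toℕ)
open import Data.Product using (Σ; ∃; _×_; _,_)
open import Relation.Binary.PropositionalEquality using (_≡_)
open import Relation.Nullary using (¬_)

module Forms {R : Set} (add mul : R → R → R) (c : Fin 10 → R) where
  A : ℕ → R
  A 1 = c (# 0)
  A 2 = c (# 1)
  A 3 = c (# 2)
  A 4 = c (# 3)
  A 5 = c (# 4)
  A 6 = c (# 5)
  A 7 = c (# 6)
  A 8 = c (# 7)
  A 9 = c (# 8)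
  A _ = c (# 9)

  infixl 6 _⊕_
  infixl 7 _⊗_
  _⊕_ _⊗_ : R → R → R
  _⊕_ = add
  _⊗_ = mul

  F : R → R → R → R
  F x y z = A 1 ⊗ x ⊗ x ⊗ x ⊕ A 2 ⊗ y ⊗ y ⊗ y ⊕ A 3 ⊗ z ⊗ z ⊗ z
          ⊕ A 4 ⊗ x ⊗ x ⊗ y ⊕ A 5 ⊗ x ⊗ x ⊗ z ⊕ A 6 ⊗ y ⊗ y ⊗ x
          ⊕ A 7 ⊗ y ⊗ y ⊗ z ⊕ A 8 ⊗ z ⊗ z ⊗ x ⊕ A 9 ⊗ z ⊗ z ⊗ y
          ⊕ A 10 ⊗ x ⊗ y ⊗ z

  Fx : R → R → R → R → R → R → R
  Fx X Y Z W M N = A 1 ⊗ X ⊗ X ⊕ A 2 ⊗ Y ⊗ W ⊕ A 3 ⊗ Z ⊗ M ⊕ A 4 ⊗ X ⊗ W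
                 ⊕ A 5 ⊗ X ⊗ M ⊕ A 6 ⊗ X ⊗ Y ⊕ A 7 ⊗ Y ⊗ M ⊕ A 8 ⊗ X ⊗ Z
                 ⊕ A 9 ⊗ Z ⊗ W ⊕ A 10 ⊗ X ⊗ N

  Fy : R → R → R → R → R → R → R
  Fy X Y Z W M N = A 1 ⊗ X ⊗ W ⊕ A 2 ⊗ Y ⊗ Y ⊕ A 3 ⊗ Z ⊗ N ⊕ A 4 ⊗ X ⊗ Y
                 ⊕ A 5 ⊗ X ⊗ N ⊕ A 6 ⊗ Y ⊗ W ⊕ A 7 ⊗ Y ⊗ N ⊕ A 8 ⊗ Z ⊗ W
                 ⊕ A 9 ⊗ Y ⊗ Z ⊕ A 10 ⊗ Y ⊗ M

  Fz : R → R → R → R → R → R → R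
  Fz X Y Z W M N = A 1 ⊗ X ⊗ M ⊕ A 2 ⊗ Y ⊗ N ⊕ A 3 ⊗ Z ⊗ Z ⊕ A 4 ⊗ X ⊗ N
                 ⊕ A 5 ⊗ X ⊗ Z ⊕ A 6 ⊗ Y ⊗ M ⊕ A 7 ⊗ Y ⊗ Z ⊕ A 8 ⊗ Z ⊗ M
                 ⊕ A 9 ⊗ Z ⊗ N ⊕ A 10 ⊗ Z ⊗ W

module FQ (c : Fin 10 → ℚ) = Forms Q._+_ Q._*_ c

CubicHasNontrivialRationalSolution : (Fin 10 → ℚ) → Set
CubicHasNontrivialRationalSolution c =
  Σ ℚ λ x → Σ ℚ λ y → Σ ℚ λ z →
    ¬ (x ≡ Q.0ℚ × y ≡ Q.0ℚ × z ≡ Q.0ℚ) × FQ.F c x y z ≡ Q.0ℚ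

SystemHasNontrivialRationalSolution : (Fin 10 → ℚ) → Set
SystemHasNontrivialRationalSolution c =
  Σ ℚ λ X → Σ ℚ λ Y → Σ ℚ λ Z → Σ ℚ λ W → Σ ℚ λ M → Σ ℚ λ N →
    ¬ (X ≡ 0ℚ × Y ≡ 0ℚ × Z ≡ 0ℚ × W ≡ 0ℚ × M ≡ 0ℚ × N ≡ 0ℚ)
    × FQ.Fx c X Y Z W M N ≡ 0ℚ
    × FQ.Fy c X Y Z W M N ≡ 0ℚ
    × FQ.Fz c X Y Z W M N ≡ 0ℚ
    × W * M - X * N ≡ 0ℚ
    × M * N - Z * W ≡ 0ℚ
    × W * N - Y * M ≡ 0ℚ
    × W * W - X * Y ≡ 0ℚ
    × M * M - X * Z ≡ 0ℚ
    × N * N - Y * Z ≡ 0ℚ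
  where open Q using (0ℚ; _*_; _-_)

-- Real place: F has a nontrivial zero over ℝ.
-- Encoded via compactness of the unit sup-sphere and continuity of F:
-- for every rational ε > 0 there is a rational point with sup-norm 1
-- where |F| < ε.  (ℚ is dense in the sphere, so this is equivalent to
-- the existence of a nontrivial real zero.)
RealSolvable : (Fin 10 → ℚ) → Set
RealSolvable c =
  (ε : ℚ) → 0ℚ < ε →
    Σ ℚ λ x → Σ ℚ λ y → Σ ℚ λ z →
      (∣ x ∣ ⊔ ∣ y ∣ ⊔ ∣ z ∣ ≡ 1ℚ) × (∣ FQ.F c x y z ∣ < ε)
  where open Q using (0ℚ; 1ℚ; _<_; ∣_∣; _⊔_)

-- Clearing denominators: integer coefficient i is
-- numerator(A_i) * ∏_{j ≠ i} denominator(A_j), i.e. D·A_i where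
-- D = ∏_j denominator(A_j) ≠ 0.  F = 0 iff D·F = 0 over any field of
-- characteristic 0, so nontrivial Q_p-zeros of F and of D·F coincide.
prodDenOthers : (Fin 10 → ℚ) → Fin 10 → ℤ
prodDenOthers c i = go 10 (λ j → j)
  where
  open import Data.Fin using (_≟_; fromℕ<)
  open import Relation.Nullary using (yes; no)
  open import Data.Nat using (_<?_)
  go : ℕ → (ℕ → ℕ) → ℤ
  go ℕ.zero f = + 1
  go (suc n) f with n <? 10
  ... | no _ = go n f
  ... | yes n<10 with fromℕ< n<10 ≟ i
  ...   | yes _ = go n f
  ...   | no _ = ↧ (c (fromℕ< n<10)) ℤ.* go n f

intCoeffs : (Fin 10 → ℚ) → Fin 10 → ℤ
intCoeffs c i = ↥ (c i) ℤ.* prodDenOthers c i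

module FZ (c : Fin 10 → ℚ) = Forms ℤ._+_ ℤ._*_ (intCoeffs c)

-- p-adic integers as the inverse limit of ℤ/p^k: a sequence of integers
-- with a(k+1) ≡ a(k) (mod p^k).
record Zp (p : ℕ) : Set where
  field
    seq : ℕ → ℤ
    coh : ∀ k → (+ (p ℕ.^ k)) ℤD.∣ (seq (suc k) ℤ.- seq k)
open Zp public

IsZeroₚ : ∀ {p} → Zp p → Set
IsZeroₚ {p} a = ∀ k → (+ (p ℕ.^ k)) ℤD.∣ seq a k

-- By homogeneity of F, a
-- nontrivial Q_p-zero can be scaled into ℤ_p, so we quantify over ℤ_p;
-- F(x,y,z) = 0 in ℤ_p means the k-th components vanish mod p^k for all k.
PadicSolvable : (p : ℕ) → (Fin 10 → ℚ) → Set
PadicSolvable p c =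
  Σ (Zp p) λ x → Σ (Zp p) λ y → Σ (Zp p) λ z →
    ¬ (IsZeroₚ x × IsZeroₚ y × IsZeroₚ z)
    × (∀ k → (+ (p ℕ.^ k)) ℤD.∣ FZ.F c (seq x k) (seq y k) (seq z k))

EverywhereLocallySolvable : (Fin 10 → ℚ) → Set
EverywhereLocallySolvable c =
  ((p : ℕ) → Prime p → PadicSolvable p c) × RealSolvable c

{-# OPTIONS --safe #-}
module Submission where

-- The six binomial relations of the system cut out the Veronese surface, the image of
-- v(x, y, z) = (x², y², z², xy, xz, yz), and Fx ∘ v = x·F, Fy ∘ v = y·F, Fz ∘ v = z·F.
-- Hence v sends a nontrivial zero of F to a solution of the system. Conversely, on the
-- surface X = Y = Z = 0 forces W = M = N = 0; if X ≠ 0, the relations give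
-- v(X, W, M) = X·(X, Y, Z, W, M, N), so X·F(X, W, M) = X²·Fx(X, Y, Z, W, M, N) = 0 and
-- (X, W, M) is a nontrivial zero of F; likewise (W, Y, N) if Y ≠ 0 and (M, N, Z) if Z ≠ 0.

open import Defs
import Algebra.Apartness.Properties.HeytingCommutativeRing as HeytingProperties
import Algebra.Properties.Group as GroupProperties
open import Data.Empty using (⊥-elim)
open import Data.Fin using (Fin; #_; toℕ)
open import Data.List using (List; _∷_; [])
open import Data.Nat using (_≤_)
open import Data.Product using (Σ; _×_; _,_)
open import Data.Rational using (ℚ; 0ℚ; _+_; _-_; _*_)
open import Data.Rational.Properties
  using (_≟_; *-comm; *-zeroʳ; +-0-group; heytingCommutativeRing; +-*-commutativeRing)
open import Function.Bundles using (_⇔_; mk⇔)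
open import Relation.Binary.PropositionalEquality
  using (_≡_; _≢_; refl; trans; cong; module ≡-Reasoning)
open import Relation.Nullary.Decidable using (yes; no; decidable-stable; dec⇒maybe)
open import Tactic.RingSolver using (solve-∀; solve)
open import Tactic.RingSolver.Core.AlmostCommutativeRing
  using (AlmostCommutativeRing; fromCommutativeRing)

open GroupProperties +-0-group using (x∙y⁻¹≈ε⇒x≈y)
open HeytingProperties heytingCommutativeRing using (x#0y#0→xy#0)

ℚ-ring : AlmostCommutativeRing _ _
ℚ-ring = fromCommutativeRing +-*-commutativeRing (λ x → dec⇒maybe (0ℚ ≟ x))

p-q≡0⇒p≡q : ∀ {p q} → p - q ≡ 0ℚ → p ≡ q
p-q≡0⇒p≡q {p} {q} = x∙y⁻¹≈ε⇒x≈y p q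

p≢0∧p*q≡0⇒q≡0 : ∀ {p q} → p ≢ 0ℚ → p * q ≡ 0ℚ → q ≡ 0ℚ
p≢0∧p*q≡0⇒q≡0 {q = q} p≢0 p*q≡0 = decidable-stable (q ≟ 0ℚ) (λ q≢0 → x#0y#0→xy#0 p≢0 q≢0 p*q≡0)

p*p≡0⇒p≡0 : ∀ {p} → p * p ≡ 0ℚ → p ≡ 0ℚ
p*p≡0⇒p≡0 {p} p*p≡0 = decidable-stable (p ≟ 0ℚ) (λ p≢0 → x#0y#0→xy#0 p≢0 p≢0 p*p≡0)

OnVeroneseSurface : (X Y Z W M N : ℚ) → Set
OnVeroneseSurface X Y Z W M N =
  W * M - X * N ≡ 0ℚ × M * N - Z * W ≡ 0ℚ × W * N - Y * M ≡ 0ℚ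
  × W * W - X * Y ≡ 0ℚ × M * M - X * Z ≡ 0ℚ × N * N - Y * Z ≡ 0ℚ

onVeroneseSurface-XYZ≡0⇒WMN≡0 : ∀ {X Y Z W M N} → X ≡ 0ℚ → Y ≡ 0ℚ → Z ≡ 0ℚ →
  OnVeroneseSurface X Y Z W M N → W ≡ 0ℚ × M ≡ 0ℚ × N ≡ 0ℚ
onVeroneseSurface-XYZ≡0⇒WMN≡0 refl refl refl (_ , _ , _ , WW≡0 , MM≡0 , NN≡0) =
  p*p≡0⇒p≡0 (p-q≡0⇒p≡q WW≡0) , p*p≡0⇒p≡0 (p-q≡0⇒p≡q MM≡0) , p*p≡0⇒p≡0 (p-q≡0⇒p≡q NN≡0)

veronese-onVeroneseSurface : ∀ x y z →
  OnVeroneseSurface (x * x) (y * y) (z * z) (x * y) (x * z) (y * z)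
veronese-onVeroneseSurface x y z =
  solve xyz ℚ-ring , solve xyz ℚ-ring , solve xyz ℚ-ring ,
  solve xyz ℚ-ring , solve xyz ℚ-ring , solve xyz ℚ-ring
  where
  xyz : List ℚ
  xyz = x ∷ y ∷ z ∷ []

Homogeneous² : (ℚ → ℚ → ℚ → ℚ → ℚ → ℚ → ℚ) → Set
Homogeneous² G = ∀ t X Y Z W M N →
  G (t * X) (t * Y) (t * Z) (t * W) (t * M) (t * N) ≡ t * t * G X Y Z W M N

homogeneous²-scaled : ∀ {G} → Homogeneous² G →
  ∀ t X Y Z W M N {X′ Y′ Z′ W′ M′ N′} →
  X′ ≡ t * X → Y′ ≡ t * Y → Z′ ≡ t * Z → W′ ≡ t * W → M′ ≡ t * M → N′ ≡ t * N →
  G X′ Y′ Z′ W′ M′ N′ ≡ t * t * G X Y Z W M N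
homogeneous²-scaled hom t X Y Z W M N refl refl refl refl refl refl = hom t X Y Z W M N

module _ (c : Fin 10 → ℚ) where
  open FQ c using (A; F; Fx; Fy; Fz)

  Fx-veronese : ∀ x y z → Fx (x * x) (y * y) (z * z) (x * y) (x * z) (y * z) ≡ x * F x y z
  Fx-veronese = expanded (A 1) (A 2) (A 3) (A 4) (A 5) (A 6) (A 7) (A 8) (A 9) (A 10)
    where
    -- The ring solver only sees operators occurring literally in the goal, so here and
    -- below the forms are unfolded by hand.
    expanded : ∀ a1 a2 a3 a4 a5 a6 a7 a8 a9 a10 x y z →
      a1 * (x * x) * (x * x) + a2 * (y * y) * (x * y) + a3 * (z * z) * (x * z) + a4 * (x * x) * (x * y) + a5 * (x * x) * (x * z)
        + a6 * (x * x) * (y * y) + a7 * (y * y) * (x * z) + a8 * (x * x) * (z * z) + a9 * (z * z) * (x * y) + a10 * (x * x) * (y * z)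
        ≡ x * (a1 * x * x * x + a2 * y * y * y + a3 * z * z * z + a4 * x * x * y + a5 * x * x * z
               + a6 * y * y * x + a7 * y * y * z + a8 * z * z * x + a9 * z * z * y + a10 * x * y * z)
    expanded = solve-∀ ℚ-ring

  Fy-veronese : ∀ x y z → Fy (x * x) (y * y) (z * z) (x * y) (x * z) (y * z) ≡ y * F x y z
  Fy-veronese = expanded (A 1) (A 2) (A 3) (A 4) (A 5) (A 6) (A 7) (A 8) (A 9) (A 10)
    where
    expanded : ∀ a1 a2 a3 a4 a5 a6 a7 a8 a9 a10 x y z →
      a1 * (x * x) * (x * y) + a2 * (y * y) * (y * y) + a3 * (z * z) * (y * z) + a4 * (x * x) * (y * y) + a5 * (x * x) * (y * z)
        + a6 * (y * y) * (x * y) + a7 * (y * y) * (y * z) + a8 * (z * z) * (x * y) + a9 * (y * y) * (z * z) + a10 * (y * y) * (x * z)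
        ≡ y * (a1 * x * x * x + a2 * y * y * y + a3 * z * z * z + a4 * x * x * y + a5 * x * x * z
               + a6 * y * y * x + a7 * y * y * z + a8 * z * z * x + a9 * z * z * y + a10 * x * y * z)
    expanded = solve-∀ ℚ-ring

  Fz-veronese : ∀ x y z → Fz (x * x) (y * y) (z * z) (x * y) (x * z) (y * z) ≡ z * F x y z
  Fz-veronese = expanded (A 1) (A 2) (A 3) (A 4) (A 5) (A 6) (A 7) (A 8) (A 9) (A 10)
    where
    expanded : ∀ a1 a2 a3 a4 a5 a6 a7 a8 a9 a10 x y z →
      a1 * (x * x) * (x * z) + a2 * (y * y) * (y * z) + a3 * (z * z) * (z * z) + a4 * (x * x) * (y * z) + a5 * (x * x) * (z * z)
        + a6 * (y * y) * (x * z) + a7 * (y * y) * (z * z) + a8 * (z * z) * (x * z) + a9 * (z * z) * (y * z) + a10 * (z * z) * (x * y)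
        ≡ z * (a1 * x * x * x + a2 * y * y * y + a3 * z * z * z + a4 * x * x * y + a5 * x * x * z
               + a6 * y * y * x + a7 * y * y * z + a8 * z * z * x + a9 * z * z * y + a10 * x * y * z)
    expanded = solve-∀ ℚ-ring

  Fx-homogeneous : Homogeneous² Fx
  Fx-homogeneous = expanded (A 1) (A 2) (A 3) (A 4) (A 5) (A 6) (A 7) (A 8) (A 9) (A 10)
    where
    expanded : ∀ a1 a2 a3 a4 a5 a6 a7 a8 a9 a10 t X Y Z W M N →
      a1 * (t * X) * (t * X) + a2 * (t * Y) * (t * W) + a3 * (t * Z) * (t * M) + a4 * (t * X) * (t * W) + a5 * (t * X) * (t * M)
        + a6 * (t * X) * (t * Y) + a7 * (t * Y) * (t * M) + a8 * (t * X) * (t * Z) + a9 * (t * Z) * (t * W) + a10 * (t * X) * (t * N)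
        ≡ t * t * (a1 * X * X + a2 * Y * W + a3 * Z * M + a4 * X * W + a5 * X * M
                   + a6 * X * Y + a7 * Y * M + a8 * X * Z + a9 * Z * W + a10 * X * N)
    expanded = solve-∀ ℚ-ring

  Fy-homogeneous : Homogeneous² Fy
  Fy-homogeneous = expanded (A 1) (A 2) (A 3) (A 4) (A 5) (A 6) (A 7) (A 8) (A 9) (A 10)
    where
    expanded : ∀ a1 a2 a3 a4 a5 a6 a7 a8 a9 a10 t X Y Z W M N →
      a1 * (t * X) * (t * W) + a2 * (t * Y) * (t * Y) + a3 * (t * Z) * (t * N) + a4 * (t * X) * (t * Y) + a5 * (t * X) * (t * N)
        + a6 * (t * Y) * (t * W) + a7 * (t * Y) * (t * N) + a8 * (t * Z) * (t * W) + a9 * (t * Y) * (t * Z) + a10 * (t * Y) * (t * M)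
        ≡ t * t * (a1 * X * W + a2 * Y * Y + a3 * Z * N + a4 * X * Y + a5 * X * N
                   + a6 * Y * W + a7 * Y * N + a8 * Z * W + a9 * Y * Z + a10 * Y * M)
    expanded = solve-∀ ℚ-ring

  Fz-homogeneous : Homogeneous² Fz
  Fz-homogeneous = expanded (A 1) (A 2) (A 3) (A 4) (A 5) (A 6) (A 7) (A 8) (A 9) (A 10)
    where
    expanded : ∀ a1 a2 a3 a4 a5 a6 a7 a8 a9 a10 t X Y Z W M N →
      a1 * (t * X) * (t * M) + a2 * (t * Y) * (t * N) + a3 * (t * Z) * (t * Z) + a4 * (t * X) * (t * N) + a5 * (t * X) * (t * Z)
        + a6 * (t * Y) * (t * M) + a7 * (t * Y) * (t * Z) + a8 * (t * Z) * (t * M) + a9 * (t * Z) * (t * N) + a10 * (t * Z) * (t * W)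
        ≡ t * t * (a1 * X * M + a2 * Y * N + a3 * Z * Z + a4 * X * N + a5 * X * Z
                   + a6 * Y * M + a7 * Y * Z + a8 * Z * M + a9 * Z * N + a10 * Z * W)
    expanded = solve-∀ ℚ-ring

  Fx≡0⇒F[X,W,M]≡0 : ∀ {X Y Z W M N} → X ≢ 0ℚ → OnVeroneseSurface X Y Z W M N →
                     Fx X Y Z W M N ≡ 0ℚ → F X W M ≡ 0ℚ
  Fx≡0⇒F[X,W,M]≡0 {X} {Y} {Z} {W} {M} {N} X≢0 (WM-XN≡0 , _ , _ , WW-XY≡0 , MM-XZ≡0 , _) Fx≡0 =
    p≢0∧p*q≡0⇒q≡0 X≢0 (begin
      X * F X W M
        ≡⟨ Fx-veronese X W M ⟨
      Fx (X * X) (W * W) (M * M) (X * W) (X * M) (W * M)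
        ≡⟨ homogeneous²-scaled Fx-homogeneous X X Y Z W M N
             refl (p-q≡0⇒p≡q WW-XY≡0) (p-q≡0⇒p≡q MM-XZ≡0) refl refl (p-q≡0⇒p≡q WM-XN≡0) ⟩
      X * X * Fx X Y Z W M N
        ≡⟨ cong (X * X *_) Fx≡0 ⟩
      X * X * 0ℚ
        ≡⟨ *-zeroʳ (X * X) ⟩
      0ℚ ∎)
    where open ≡-Reasoning

  Fy≡0⇒F[W,Y,N]≡0 : ∀ {X Y Z W M N} → Y ≢ 0ℚ → OnVeroneseSurface X Y Z W M N →
                     Fy X Y Z W M N ≡ 0ℚ → F W Y N ≡ 0ℚ
  Fy≡0⇒F[W,Y,N]≡0 {X} {Y} {Z} {W} {M} {N} Y≢0 (_ , _ , WN-YM≡0 , WW-XY≡0 , _ , NN-YZ≡0) Fy≡0 =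
    p≢0∧p*q≡0⇒q≡0 Y≢0 (begin
      Y * F W Y N
        ≡⟨ Fy-veronese W Y N ⟨
      Fy (W * W) (Y * Y) (N * N) (W * Y) (W * N) (Y * N)
        ≡⟨ homogeneous²-scaled Fy-homogeneous Y X Y Z W M N
             (trans (p-q≡0⇒p≡q WW-XY≡0) (*-comm X Y)) refl (p-q≡0⇒p≡q NN-YZ≡0)
             (*-comm W Y) (p-q≡0⇒p≡q WN-YM≡0) refl ⟩
      Y * Y * Fy X Y Z W M N
        ≡⟨ cong (Y * Y *_) Fy≡0 ⟩
      Y * Y * 0ℚ
        ≡⟨ *-zeroʳ (Y * Y) ⟩
      0ℚ ∎)
    where open ≡-Reasoning

  Fz≡0⇒F[M,N,Z]≡0 : ∀ {X Y Z W M N} → Z ≢ 0ℚ → OnVeroneseSurface X Y Z W M N →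
                     Fz X Y Z W M N ≡ 0ℚ → F M N Z ≡ 0ℚ
  Fz≡0⇒F[M,N,Z]≡0 {X} {Y} {Z} {W} {M} {N} Z≢0 (_ , MN-ZW≡0 , _ , _ , MM-XZ≡0 , NN-YZ≡0) Fz≡0 =
    p≢0∧p*q≡0⇒q≡0 Z≢0 (begin
      Z * F M N Z
        ≡⟨ Fz-veronese M N Z ⟨
      Fz (M * M) (N * N) (Z * Z) (M * N) (M * Z) (N * Z)
        ≡⟨ homogeneous²-scaled Fz-homogeneous Z X Y Z W M N
             (trans (p-q≡0⇒p≡q MM-XZ≡0) (*-comm X Z)) (trans (p-q≡0⇒p≡q NN-YZ≡0) (*-comm Y Z)) refl
             (p-q≡0⇒p≡q MN-ZW≡0) (*-comm M Z) (*-comm N Z) ⟩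
      Z * Z * Fz X Y Z W M N
        ≡⟨ cong (Z * Z *_) Fz≡0 ⟩
      Z * Z * 0ℚ
        ≡⟨ *-zeroʳ (Z * Z) ⟩
      0ℚ ∎)
    where open ≡-Reasoning

  cubic⇒system : CubicHasNontrivialRationalSolution c → SystemHasNontrivialRationalSolution c
  cubic⇒system (x , y , z , nontrivial , F≡0) =
    x * x , y * y , z * z , x * y , x * z , y * z ,
    (λ (xx≡0 , yy≡0 , zz≡0 , _) → nontrivial (p*p≡0⇒p≡0 xx≡0 , p*p≡0⇒p≡0 yy≡0 , p*p≡0⇒p≡0 zz≡0)) ,
    trans (Fx-veronese x y z) (multiple-of-F≡0 x) ,
    trans (Fy-veronese x y z) (multiple-of-F≡0 y) ,
    trans (Fz-veronese x y z) (multiple-of-F≡0 z) ,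
    veronese-onVeroneseSurface x y z
    where
    multiple-of-F≡0 : ∀ u → u * F x y z ≡ 0ℚ
    multiple-of-F≡0 u = trans (cong (u *_) F≡0) (*-zeroʳ u)

  system⇒cubic : SystemHasNontrivialRationalSolution c → CubicHasNontrivialRationalSolution c
  system⇒cubic (X , Y , Z , W , M , N , nontrivial , Fx≡0 , Fy≡0 , Fz≡0 , onSurface)
    with X ≟ 0ℚ | Y ≟ 0ℚ | Z ≟ 0ℚ
  ... | no X≢0 | _ | _ =
    X , W , M , (λ (X≡0 , _) → X≢0 X≡0) , Fx≡0⇒F[X,W,M]≡0 X≢0 onSurface Fx≡0
  ... | yes _ | no Y≢0 | _ =
    W , Y , N , (λ (_ , Y≡0 , _) → Y≢0 Y≡0) , Fy≡0⇒F[W,Y,N]≡0 Y≢0 onSurface Fy≡0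
  ... | yes _ | yes _ | no Z≢0 =
    M , N , Z , (λ (_ , _ , Z≡0) → Z≢0 Z≡0) , Fz≡0⇒F[M,N,Z]≡0 Z≢0 onSurface Fz≡0
  ... | yes X≡0 | yes Y≡0 | yes Z≡0 =
    ⊥-elim (nontrivial (X≡0 , Y≡0 , Z≡0 , onVeroneseSurface-XYZ≡0⇒WMN≡0 X≡0 Y≡0 Z≡0 onSurface))

-- The equivalence is purely algebraic: neither the conditions on the coefficients nor
-- local solvability is needed.
proposition3p3 : (A : Fin 10 → ℚ)
    → A (# 0) * A (# 1) * A (# 2) ≢ 0ℚ
    → Σ (Fin 10) (λ i → (3 ≤ toℕ i) × (A i ≢ 0ℚ))
    → EverywhereLocallySolvable A
    → SystemHasNontrivialRationalSolution A ⇔ CubicHasNontrivialRationalSolution A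
proposition3p3 A _ _ _ = mk⇔ (system⇒cubic A) (cubic⇒system A)
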